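{- Let $H$ and $I$ be undirected graphs such that $I$ is an induced minor of $H$. Then $\operatorname{dtd}(H)\ge \operatorname{dtd}(I)$.
   Context: $I$ is an induced minor of $H$ if $I$ can be obtained from $H$ by deleting vertices and contracting edges. For a DAG $\vec H$, a source is a vertex of indegree $0$ and $R(s)$ is the set of vertices reachable from $s$ by a directed path. A DAG elimination forest of $\vec H$ is defined recursively: if $\vec H$ is empty, the forest is empty; if $\vec H$ has exactly one source (and is connected), it is a single node; if the underlying undirected graph is disconnected, it is the union of DAG elimination forests of the components; otherwise it is a tree obtained by picking any source $s$, deleting $s$ and $R(s)$, making $s$ the root and letting its subtrees be the trees of a DAG elimination forest of the remaining DAG. $\operatorname{dtd}(\vec H)$ is the minimum over such forests of the maximum number of nodes on a root-to-leaf path. For an undirected graph $H$, $\operatorname{dtd}(H)$ is the maximum of $\operatorname{dtd}(\vec H)$ over all acyclic orientations $\vec H$ of $H$. -}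

module Defs where

open import Level using (0ℓ)
open import Data.Nat using (ℕ; zero; suc; _⊔_; _≤_)
open import Data.Fin using (Fin; punchIn)
open import Data.Fin.Properties using (_≟_)
open import Data.Product using (Σ; _×_; _,_; proj₁; proj₂)
open import Data.Sum using (_⊎_; inj₁; inj₂)
open import Data.Unit using (⊤)
open import Relation.Nullary using (¬_; Dec; yes; no)
open import Relation.Nullary.Decidable using (_×-dec_; _⊎-dec_; ¬?)
open import Relation.Unary using (Pred)
open import Relation.Binary using (Rel)
open import Relation.Binary.Definitions using (Decidable)
open import Relation.Binary.PropositionalEquality using (_≡_; _≢_; refl; sym)
open import Relation.Binary.Construct.Closure.Transitive using (TransClosure)

record Graph (n : ℕ) : Set₁ where
  field
    Adj    : Rel (Fin n) 0ℓ
    adj?   : Decidable Adj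
    symm   : ∀ {u v} → Adj u v → Adj v u
    irrefl : ∀ {u} → ¬ Adj u u

open Graph public

record _≅_ {m n : ℕ} (I : Graph m) (H : Graph n) : Set where
  field
    to       : Fin m → Fin n
    from     : Fin n → Fin m
    from∘to  : ∀ x → from (to x) ≡ x
    to∘from  : ∀ y → to (from y) ≡ y
    pres     : ∀ {x y} → Adj I x y → Adj H (to x) (to y)
    refl'    : ∀ {x y} → Adj H (to x) (to y) → Adj I x y

deleteVertex : {n : ℕ} → Graph (suc n) → Fin (suc n) → Graph n
deleteVertex H v = record
  { Adj    = λ i j → Adj H (punchIn v i) (punchIn v j)
  ; adj?   = λ i j → adj? H (punchIn v i) (punchIn v j)
  ; symm   = symm H
  ; irrefl = irrefl H
  }

-- Edge contraction: contract the edge uv (u ≠ v since Adj u v);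
-- v is removed and merged into u.  Vertex i of the new graph is
-- punchIn v i of the old graph.

private
  CAdj : {n : ℕ} → Graph (suc n) → (u v : Fin (suc n)) → Rel (Fin n) 0ℓ
  CAdj H u v i j =
    (Adj H (punchIn v i) (punchIn v j)
      ⊎ (punchIn v i ≡ u × Adj H v (punchIn v j))
      ⊎ (punchIn v j ≡ u × Adj H (punchIn v i) v))
    × i ≢ j

  CAdj? : {n : ℕ} (H : Graph (suc n)) (u v : Fin (suc n)) → Decidable (CAdj H u v)
  CAdj? H u v i j =
    (adj? H (punchIn v i) (punchIn v j)
      ⊎-dec ((punchIn v i ≟ u) ×-dec adj? H v (punchIn v j))
      ⊎-dec ((punchIn v j ≟ u) ×-dec adj? H (punchIn v i) v))
    ×-dec ¬? (i ≟ j)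

  CSym : {n : ℕ} (H : Graph (suc n)) (u v : Fin (suc n)) → ∀ {i j} → CAdj H u v i j → CAdj H u v j i
  CSym H u v (inj₁ a , ne) = inj₁ (symm H a) , λ e → ne (sym e)
  CSym H u v (inj₂ (inj₁ (e , a)) , ne) = inj₂ (inj₂ (e , symm H a)) , λ e' → ne (sym e')
  CSym H u v (inj₂ (inj₂ (e , a)) , ne) = inj₂ (inj₁ (e , symm H a)) , λ e' → ne (sym e')

contract : {n : ℕ} (H : Graph (suc n)) (u v : Fin (suc n)) → Adj H u v → Graph n
contract H u v _ = record
  { Adj    = CAdj H u v
  ; adj?   = CAdj? H u v
  ; symm   = CSym H u v
  ; irrefl = λ c → proj₂ c refl
  }

data _≤IM_ {m : ℕ} (I : Graph m) : {n : ℕ} → Graph n → Set₁ where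
  iso : ∀ {n} {H : Graph n} → I ≅ H → I ≤IM H
  del : ∀ {n} {H : Graph (suc n)} (v : Fin (suc n)) →
        I ≤IM deleteVertex H v → I ≤IM H
  con : ∀ {n} {H : Graph (suc n)} (u v : Fin (suc n)) (e : Adj H u v) →
        I ≤IM contract H u v e → I ≤IM H

record AcyclicOrientation {n : ℕ} (G : Graph n) : Set₁ where
  field
    Arc     : Rel (Fin n) 0ℓ
    arc⇒adj : ∀ {u v} → Arc u v → Adj G u v
    adj⇒arc : ∀ {u v} → Adj G u v → Arc u v ⊎ Arc v u
    acyclic : ∀ u → ¬ TransClosure Arc u u

open AcyclicOrientation public

-- DAG elimination forests of the sub-DAG induced on a vertex set S of
-- a DAG with arc relation E; Elim E S d means: there is a DAG
-- elimination forest of the DAG induced on S whose maximum number of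
-- nodes on a root-to-leaf path is d.

module _ {n : ℕ} (E : Rel (Fin n) 0ℓ) where

  data Linked (S : Pred (Fin n) 0ℓ) : Fin n → Fin n → Set where
    here : ∀ {u} → S u → Linked S u u
    step : ∀ {u v w} → Linked S u v → S w → (E v w ⊎ E w v) → Linked S u w

  data Reach (S : Pred (Fin n) 0ℓ) : Fin n → Fin n → Set where
    here : ∀ {u} → S u → Reach S u u
    step : ∀ {u v w} → Reach S u v → S w → E v w → Reach S u w

  Connected : Pred (Fin n) 0ℓ → Set
  Connected S = ∀ {u v} → S u → S v → Linked S u v

  IsSource : Pred (Fin n) 0ℓ → Fin n → Set
  IsSource S s = S s × (∀ {u} → S u → ¬ E u s)

  data Elim : Pred (Fin n) 0ℓ → ℕ → Set₁ where
    empty : ∀ {S} → (∀ u → ¬ S u) → Elim S 0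
    -- disconnected: union of a forest for the component of v and a
    -- forest for the rest (recursively: union over all components)
    split : ∀ {S v d₁ d₂} → S v → ¬ Connected S →
            Elim (λ u → Linked S v u) d₁ →
            Elim (λ u → S u × ¬ Linked S v u) d₂ →
            Elim S (d₁ ⊔ d₂)
    -- connected: pick a source s as root, delete s and R(s); the
    -- subtrees form a forest of the rest.  (With exactly one source this
    -- gives the single-node tree.)
    root  : ∀ {S s d} → Connected S → IsSource S s →
            Elim (λ u → S u × ¬ Reach S s u) d →
            Elim S (suc d)

DagDtdAtLeast : {n : ℕ} → Rel (Fin n) 0ℓ → ℕ → Set₁
DagDtdAtLeast E k = ∀ d → Elim E (λ _ → ⊤) d → k ≤ d

DtdAtLeast : {n : ℕ} → Graph n → ℕ → Set₁
DtdAtLeast G k = Σ (AcyclicOrientation G) λ O → DagDtdAtLeast (Arc O) k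

module Submission where

-- Orient H from an acyclic orientation of I: a deleted vertex becomes a sink, a contracted edge
-- uv is oriented u → v, and every other edge follows the arc between the images of its ends.
-- The oriented I is then a minor of the oriented H along a map whose domain is closed under
-- predecessors, and every DAG elimination forest of H pushes forward to one of I that is no
-- deeper: components go to unions of components, and a root s goes to a vertex i such that R(s)
-- maps into R(i). Deleting R(i) costs at most one level even when i is not a source, because a
-- source reaching i can root its component, and forests restrict to predecessor-closed subsets.
-- Excluded middle is only used under double negation, which suffices as k ≤ d is decidable.

open import Level using (0ℓ)
open import Data.Nat using (ℕ; zero; suc; _⊔_; _≤_; _≤?_; s≤s; z≤n)
open import Data.Nat.Properties
  using (≤-refl; ≤-trans; ≤-reflexive; ⊔-lub; ⊔-assoc; ⊔-mono-≤; ⊔-monoʳ-≤; m≤m⊔n; n≤1+n)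
open import Data.Fin using (Fin; zero; suc; punchIn; punchOut)
open import Data.Fin.Properties using (_≟_; punchIn-injective; punchInᵢ≢i; punchIn-punchOut)
open import Data.Product using (∃₂; ∃-syntax; Σ-syntax; _×_; _,_; proj₁; proj₂)
open import Data.Sum using (_⊎_; inj₁; inj₂; [_,_]; swap)
import Data.Sum as Sum
open import Data.Empty using (⊥-elim)
open import Data.Unit using (⊤; tt)
open import Function using (id; _∘_)
open import Relation.Nullary using (¬_; yes; no)
open import Relation.Nullary.Negation using (DoubleNegation; ¬¬-map)
open import Relation.Nullary.Decidable using (¬¬-excluded-middle; decidable-stable; toSum)
open import Relation.Unary using (Pred; _⊆_; _≐_; _∪_; _∩_; _∖_; _⊥_; Satisfiable)
  renaming (Decidable to Decidable₁)
open import Relation.Unary.Properties using (≐-refl; ≐-sym)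
open import Relation.Binary using (Rel; _⇒_; Transitive)
open import Relation.Binary.Structures using (IsStrictPartialOrder)
open import Relation.Binary.PropositionalEquality
  using (_≡_; _≢_; refl; sym; trans; cong; subst; subst₂; isEquivalence)
open import Relation.Binary.Construct.Closure.Transitive using (TransClosure; _∷_; _++_; wellFounded⁻)
  renaming ([_] to [_]⁺)
open import Data.Fin.Induction using (spo-wellFounded)
open import Induction.WellFounded using (Acc; acc; WellFounded)
open import Defs

-- The standard ¬¬-Monad is single-levelled, but the binds below go from Set to Set₁.
infixl 1 _>>=_

_>>=_ : ∀ {a b} {A : Set a} {B : Set b} →
        DoubleNegation A → (A → DoubleNegation B) → DoubleNegation B
(m >>= f) ¬b = m (λ a → f a ¬b)

return : ∀ {a} {A : Set a} → A → DoubleNegation A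
return a ¬a = ¬a a

¬¬-decidable : ∀ {n} (P : Pred (Fin n) 0ℓ) → DoubleNegation (Decidable₁ P)
¬¬-decidable {zero}  P = return λ ()
¬¬-decidable {suc n} P = do
  P0? ← ¬¬-excluded-middle
  P+? ← ¬¬-decidable (P ∘ suc)
  return λ { zero → P0? ; (suc i) → P+? i }

partition-≐ : ∀ {A : Set} {P T : Pred A 0ℓ} → Decidable₁ P → T ≐ (T ∩ P) ∪ (T ∖ P)
partition-≐ P? = (λ {x} t → Sum.map (t ,_) (t ,_) (toSum (P? x))) , [ proj₁ , proj₁ ]

module Elimination {n : ℕ} (E : Rel (Fin n) 0ℓ) where

  private variable
    S T U A B : Pred (Fin n) 0ℓ
    s w x y z : Fin n
    d d₁ d₂ : ℕ

  Edge : Rel (Fin n) 0ℓ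
  Edge x y = E x y ⊎ E y x

  DownClosedIn : Pred (Fin n) 0ℓ → Pred (Fin n) 0ℓ → Set
  DownClosedIn S T = ∀ {x y} → S x → E x y → T y → T x

  DownClosed : Pred (Fin n) 0ℓ → Set
  DownClosed T = ∀ {x y} → E x y → T y → T x

  EdgeClosedIn : Pred (Fin n) 0ℓ → Pred (Fin n) 0ℓ → Set
  EdgeClosedIn S A = ∀ {x y} → A x → S y → Edge x y → A y

  Separated : Pred (Fin n) 0ℓ → Pred (Fin n) 0ℓ → Set
  Separated A B = ∀ {x y} → A x → B y → ¬ Edge x y

  linked-start : Linked E S x y → S x
  linked-start (here Sx)     = Sx
  linked-start (step xy _ _) = linked-start xy

  linked-end : Linked E S x y → S y
  linked-end (here Sy)     = Sy
  linked-end (step _ Sy _) = Sy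

  linked-mono : S ⊆ T → Linked E S x y → Linked E T x y
  linked-mono S⊆T (here Sx)       = here (S⊆T Sx)
  linked-mono S⊆T (step xy Sz yz) = step (linked-mono S⊆T xy) (S⊆T Sz) yz

  linked-trans : Linked E S x y → Linked E S y z → Linked E S x z
  linked-trans xy (here _)        = xy
  linked-trans xy (step yz Sw zw) = step (linked-trans xy yz) Sw zw

  linked-sym : Linked E S x y → Linked E S y x
  linked-sym (here Sx)       = here Sx
  linked-sym (step xy Sz yz) = linked-trans (step (here Sz) (linked-end xy) (swap yz)) (linked-sym xy)

  linked-confined : EdgeClosedIn S A → A x → Linked E S x y → Linked E A x y
  linked-confined closed Ax (here _)       = here Ax
  linked-confined closed Ax (step xy Sz e) =
    let xy′ = linked-confined closed Ax xy in step xy′ (closed (linked-end xy′) Sz e) e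

  linked-≐ : S ≐ T → Linked E S w ≐ Linked E T w
  linked-≐ (S⊆T , T⊆S) = linked-mono S⊆T , linked-mono T⊆S

  component-closed : EdgeClosedIn S (Linked E S w)
  component-closed wx Sy e = step wx Sy e

  component-≐ : A ⊆ S → EdgeClosedIn S A → A w → Linked E S w ≐ Linked E A w
  component-≐ A⊆S closed Aw = linked-confined closed Aw , linked-mono A⊆S

  component-connected : Connected E (Linked E S w)
  component-connected wx wy = linked-trans (linked-sym (self wx)) (self wy)
    where
    self : Linked E S w x → Linked E (Linked E S w) w x
    self wx = linked-confined component-closed (here (linked-start wx)) wx

  reach-start : Reach E S x y → S x
  reach-start (here Sx)     = Sx
  reach-start (step xy _ _) = reach-start xy

  reach⇒linked : Reach E S x y → Linked E S x y
  reach⇒linked (here Sx)       = here Sx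
  reach⇒linked (step xy Sz yz) = step (reach⇒linked xy) Sz (inj₁ yz)

  reach-mono : S ⊆ T → Reach E S x y → Reach E T x y
  reach-mono S⊆T (here Sx)       = here (S⊆T Sx)
  reach-mono S⊆T (step xy Sz yz) = step (reach-mono S⊆T xy) (S⊆T Sz) yz

  reach-≐ : S ≐ T → Reach E S w ≐ Reach E T w
  reach-≐ (S⊆T , T⊆S) = reach-mono S⊆T , reach-mono T⊆S

  reach-trans : Reach E S x y → Reach E S y z → Reach E S x z
  reach-trans xy (here _)        = xy
  reach-trans xy (step yz Sw zw) = step (reach-trans xy yz) Sw zw

  reach-downClosed : DownClosedIn S T → Reach E S x y → T y → Reach E T x y
  reach-downClosed closed (here _)        Ty = here Ty
  reach-downClosed closed (step xz Sy zy) Ty =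
    step (reach-downClosed closed xz (closed (reach-end xz) zy Ty)) Ty zy
    where
    reach-end : Reach E S x z → S z
    reach-end (here Sz)     = Sz
    reach-end (step _ Sz _) = Sz

  reach-component : Reach E S x y → Reach E (Linked E S x) x y
  reach-component (here Sx)       = here (here Sx)
  reach-component (step xy Sz yz) =
    step (reach-component xy) (step (reach⇒linked xy) Sz (inj₁ yz)) yz

  ∖-cong : A ≐ B → S ≐ T → A ∖ S ≐ B ∖ T
  ∖-cong (A⊆B , B⊆A) (S⊆T , T⊆S) =
    (λ (a , ¬s) → A⊆B a , ¬s ∘ T⊆S) , (λ (b , ¬t) → B⊆A b , ¬t ∘ S⊆T)

  elim-cong : Elim E S d → S ≐ T → Elim E T d
  elim-cong (empty ∅S) (_ , T⊆S) = empty (λ u → ∅S u ∘ T⊆S)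
  elim-cong (split Sv ¬conn eC eR) S≐T@(S⊆T , T⊆S) =
    split (S⊆T Sv) (λ conn → ¬conn (λ a b → linked-mono T⊆S (conn (S⊆T a) (S⊆T b))))
      (elim-cong eC (linked-≐ S≐T))
      (elim-cong eR (∖-cong S≐T (linked-≐ S≐T)))
  elim-cong (root conn (Ss , source) eR) S≐T@(S⊆T , T⊆S) =
    root (λ a b → linked-mono S⊆T (conn (T⊆S a) (T⊆S b))) (S⊆T Ss , source ∘ T⊆S)
      (elim-cong eR (∖-cong S≐T (reach-≐ S≐T)))

  Elim≤ : Pred (Fin n) 0ℓ → ℕ → Set₁
  Elim≤ S d = ∃[ d′ ] d′ ≤ d × Elim E S d′

  elim≤-weaken : d₁ ≤ d₂ → Elim≤ S d₁ → Elim≤ S d₂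
  elim≤-weaken d₁≤d₂ (d , d≤d₁ , e) = d , ≤-trans d≤d₁ d₁≤d₂ , e

  separated-component : A ⊆ T → T ⊆ A ∪ B → Separated A B → A w → Linked E T w ≐ Linked E A w
  separated-component A⊆T T⊆A∪B sep = component-≐ A⊆T closed
    where
    closed : EdgeClosedIn _ _
    closed Ax Ty e = [ id , (λ By → ⊥-elim (sep Ax By e)) ] (T⊆A∪B Ty)

  elim≤-union : Elim E A d₁ → Elim E B d₂ → T ≐ A ∪ B → A ⊥ B → Separated A B →
                DoubleNegation (Elim≤ T (d₁ ⊔ d₂))
  elim≤-union {d₂ = d₂} (empty ∅A) eB (T⊆A∪B , A∪B⊆T) _ _ =
    return (d₂ , ≤-refl ,
            elim-cong eB (A∪B⊆T ∘ inj₂ , λ t → [ ⊥-elim ∘ ∅A _ , id ] (T⊆A∪B t)))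
  elim≤-union {A = A} {B = B} {d₂ = d₂} {T = T}
              (split {v = w} {d₁ = c₁} {d₂ = c₂} Aw ¬connA eC eR) eB (T⊆A∪B , A∪B⊆T) A⊥B sep = do
    (d , d≤ , eR∪B) ← elim≤-union eR eB ≐-refl (λ ((a , _) , b) → A⊥B (a , b)) (sep ∘ proj₁)
    return (c₁ ⊔ d , bound d≤ ,
            split (A⊆T Aw) ¬connT (elim-cong eC (≐-sym comp≐)) (elim-cong eR∪B rest≐))
    where
    A⊆T : A ⊆ T
    A⊆T = A∪B⊆T ∘ inj₁
    comp≐ : Linked E T w ≐ Linked E A w
    comp≐ = separated-component A⊆T T⊆A∪B sep Aw
    ¬connT : ¬ Connected E T
    ¬connT conn =
      ¬connA (λ a b → proj₁ (separated-component A⊆T T⊆A∪B sep a) (conn (A⊆T a) (A⊆T b)))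
    rest≐ : (A ∖ Linked E A w) ∪ B ≐ T ∖ Linked E T w
    rest≐ = [ (λ (a , ¬l) → A⊆T a , ¬l ∘ proj₁ comp≐)
            , (λ b → A∪B⊆T (inj₂ b) , λ l → A⊥B (linked-end (proj₁ comp≐ l) , b)) ]
          , λ (t , ¬l) → [ (λ a → inj₁ (a , ¬l ∘ proj₂ comp≐)) , inj₂ ] (T⊆A∪B t)
    bound : ∀ {d} → d ≤ c₂ ⊔ d₂ → c₁ ⊔ d ≤ (c₁ ⊔ c₂) ⊔ d₂
    bound d≤ = ≤-trans (⊔-monoʳ-≤ c₁ d≤) (≤-reflexive (sym (⊔-assoc c₁ c₂ d₂)))
  elim≤-union {A = A} {B = B} {d₂ = d₂} {T = T}
              eA@(root {s = s} {d = c} connA (As , _) _) eB (T⊆A∪B , A∪B⊆T) A⊥B sep = do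
    yes (_ , Bb) ← ¬¬-excluded-middle {A = Satisfiable B}
      where no ∄B → return (suc c , m≤m⊔n (suc c) d₂ ,
                            elim-cong eA (A⊆T , λ t → [ id , ⊥-elim ∘ ∄B ∘ (_ ,_) ] (T⊆A∪B t)))
    return (suc c ⊔ d₂ , ≤-refl ,
            split (A⊆T As) (¬connT Bb) (elim-cong eA A≐comp) (elim-cong eB B≐rest))
    where
    A⊆T : A ⊆ T
    A⊆T = A∪B⊆T ∘ inj₁
    comp≐ : Linked E T s ≐ Linked E A s
    comp≐ = separated-component A⊆T T⊆A∪B sep As
    A≐comp : A ≐ Linked E T s
    A≐comp = (λ a → proj₂ comp≐ (connA As a)) , linked-end ∘ proj₁ comp≐
    ¬connT : B x → ¬ Connected E T
    ¬connT Bx conn = A⊥B (linked-end (proj₁ comp≐ (conn (A⊆T As) (A∪B⊆T (inj₂ Bx)))) , Bx)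
    B≐rest : B ≐ T ∖ Linked E T s
    B≐rest = (λ b → A∪B⊆T (inj₂ b) , λ l → A⊥B (linked-end (proj₁ comp≐ l) , b))
           , λ (t , ¬l) → [ (λ a → ⊥-elim (¬l (proj₁ A≐comp a))) , id ] (T⊆A∪B t)

  mutual
    elim≤-downClosed : Elim E S d → T ⊆ S → DownClosedIn S T → DoubleNegation (Elim≤ T d)
    elim≤-downClosed (empty ∅S) T⊆S _ = return (0 , ≤-refl , empty (λ u → ∅S u ∘ T⊆S))
    elim≤-downClosed {S = S} {T = T} (split {v = w} _ _ eC eR) T⊆S closed = do
      L? ← ¬¬-decidable (Linked E S w)
      (_ , ≤c₁ , e₁) ← elim≤-downClosed eC proj₂ (λ wx e (Ty , _) → closed (linked-end wx) e Ty , wx)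
      (_ , ≤c₂ , e₂) ← elim≤-downClosed eR (λ (t , ¬l) → T⊆S t , ¬l)
                         (λ (Sx , ¬wx) e (Ty , _) → closed Sx e Ty , ¬wx)
      (d , d≤ , e) ← elim≤-union e₁ e₂ (partition-≐ L?) (λ ((_ , l) , (_ , ¬l)) → ¬l l)
                       (λ (_ , wx) (Ty , ¬wy) e → ¬wy (step wx (T⊆S Ty) e))
      return (d , ≤-trans d≤ (⊔-mono-≤ ≤c₁ ≤c₂) , e)
    elim≤-downClosed {T = T} (root {s = s} {d = c} _ (_ , source) eR) T⊆S closed = do
      yes Ts ← ¬¬-excluded-middle {A = T s}
        where no ¬Ts → ¬¬-map (elim≤-weaken (n≤1+n c))
                (elim≤-downClosed eR
                  (λ t → T⊆S t , λ r → ¬Ts (reach-start (reach-downClosed closed r t)))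
                  (λ (Sx , _) e Ty → closed Sx e Ty))
      elim≤-rooted (Ts , source ∘ T⊆S) eR
        (λ (t , ¬r) → T⊆S t , λ r → ¬r (reach-downClosed closed r t))
        (λ (Sx , _) e (Ty , ¬sy) → closed Sx e Ty , λ sx → ¬sy (step sx Ty e))

    elim≤-rooted : IsSource E T s → Elim E U d →
                   T ∖ Reach E T s ⊆ U → DownClosedIn U (T ∖ Reach E T s) →
                   DoubleNegation (Elim≤ T (suc d))
    elim≤-rooted {T = T} {s = s} {U = U} {d = d} (Ts , source) eU T′⊆U closed = do
      C? ← ¬¬-decidable C
      (_ , ≤d₁ , e₁) ← elim≤-downClosed eU (T′⊆U ∘ inComp) closed₁
      (_ , ≤d₂ , e₂) ← elim≤-downClosed eU (T′⊆U ∘ outComp) closed₂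
      (d′ , d′≤ , e) ← elim≤-union
                         (elim-cong (root component-connected (here Ts , source ∘ linked-end) e₁) C≐T∩C) e₂
                         (partition-≐ C?) (λ ((_ , c) , (_ , ¬c)) → ¬c c)
                         (λ (_ , c) (Ty , ¬c) e → ¬c (step c Ty e))
      return (d′ , ≤-trans d′≤ (⊔-lub (s≤s ≤d₁) (≤-trans ≤d₂ (n≤1+n d))) , e)
      where
      C : Pred (Fin n) 0ℓ
      C = Linked E T s
      C≐T∩C : C ≐ T ∩ C
      C≐T∩C = (λ c → linked-end c , c) , proj₂
      inComp : C ∖ Reach E C s ⊆ T ∖ Reach E T s
      inComp (c , ¬r) = linked-end c , ¬r ∘ reach-component
      outComp : T ∖ C ⊆ T ∖ Reach E T s
      outComp (t , ¬c) = t , ¬c ∘ reach⇒linked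
      closed₁ : DownClosedIn U (C ∖ Reach E C s)
      closed₁ Ux e (cy , ¬ry) =
        step cy (proj₁ (closed Ux e (linked-end cy , ¬ry ∘ reach-component))) (inj₂ e) ,
        λ rx → ¬ry (step rx cy e)
      closed₂ : DownClosedIn U (T ∖ C)
      closed₂ Ux e (Ty , ¬cy) =
        proj₁ (closed Ux e (Ty , ¬cy ∘ reach⇒linked)) , λ cx → ¬cy (step cx Ty (inj₁ e))

  source-reaching : Acc E w → T w → DoubleNegation (∃[ s ] IsSource E T s × Reach E T s w)
  source-reaching {w = w} {T = T} (acc smaller) Tw = do
    yes (x , Tx , xw) ← ¬¬-excluded-middle {A = ∃[ x ] T x × E x w}
      where no ∄ → return (w , (Tw , λ {u} Tu uw → ∄ (u , Tu , uw)) , here Tw)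
    (s , source , sx) ← source-reaching (smaller xw) Tx
    return (s , source , step sx Tw xw)

  elim≤-removeReach : WellFounded E → T w → Elim E (T ∖ Reach E T w) d →
                      DoubleNegation (Elim≤ T (suc d))
  elim≤-removeReach wf Tw eR = do
    (s , source , sw) ← source-reaching (wf _) Tw
    elim≤-rooted source eR (λ (t , ¬r) → t , ¬r ∘ reach-trans sw)
      (λ (Tx , _) e (Ty , ¬sy) → Tx , λ sx → ¬sy (step sx Ty e))

-- x ↦ i says that x lies in the branch set of i; vertices without an image are the deleted ones.
record MinorModel {N M : ℕ} (E : Rel (Fin N) 0ℓ) (E′ : Rel (Fin M) 0ℓ) : Set₁ where
  field
    _↦_          : Fin N → Fin M → Set
    ↦-functional : ∀ {x i j} → x ↦ i → x ↦ j → i ≡ j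
    ↦-surjective : ∀ i → ∃[ x ] x ↦ i
    ↦-downward   : ∀ {x y j} → E x y → y ↦ j → ∃[ i ] x ↦ i
    arc-image    : ∀ {x y i j} → E x y → x ↦ i → y ↦ j → i ≡ j ⊎ E′ i j
    arc-lift     : ∀ {i j} → E′ i j → ∃₂ λ x y → x ↦ i × y ↦ j × (E x y ⊎ E y x)
    fibre-clique : ∀ {x y i} → x ↦ i → y ↦ i → x ≡ y ⊎ (E x y ⊎ E y x)

module _ {N M : ℕ} {E : Rel (Fin N) 0ℓ} {E′ : Rel (Fin M) 0ℓ} (model : MinorModel E E′) where
  open MinorModel model
  open Elimination E using (Edge)
  private module I = Elimination E′

  private variable
    S : Pred (Fin N) 0ℓ
    T : Pred (Fin M) 0ℓ
    s w x y : Fin N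
    i j : Fin M
    d : ℕ

  Preimage : Pred (Fin M) 0ℓ → Pred (Fin N) 0ℓ
  Preimage T x = ∃[ i ] x ↦ i × T i

  edge-lift : I.Edge i j → ∃₂ λ x y → x ↦ i × y ↦ j × Edge x y
  edge-lift (inj₁ ij) = arc-lift ij
  edge-lift (inj₂ ji) = let (x , y , x↦j , y↦i , xy) = arc-lift ji in y , x , y↦i , x↦j , swap xy

  fibre-linked : x ↦ i → y ↦ i → S y → Linked E S w x → Linked E S w y
  fibre-linked x↦i y↦i Sy wx with fibre-clique x↦i y↦i
  ... | inj₁ refl = wx
  ... | inj₂ xy   = step wx Sy xy

  reach-domain : Reach E S s y → y ↦ j → ∃[ i ] s ↦ i
  reach-domain (here _)       y↦j = _ , y↦j
  reach-domain (step sx _ xy) y↦j = reach-domain sx (proj₂ (↦-downward xy y↦j))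

  reach-image : I.DownClosed T → Reach E S s y → s ↦ i → y ↦ j → T j → Reach E′ T i j
  reach-image down (here _) s↦i s↦j Tj with ↦-functional s↦i s↦j
  ... | refl = here Tj
  reach-image down (step sx _ xy) s↦i y↦j Tj with ↦-downward xy y↦j
  ... | k , x↦k with arc-image xy x↦k y↦j
  ... | inj₁ refl = reach-image down sx s↦i x↦k Tj
  ... | inj₂ kj   = step (reach-image down sx s↦i x↦k (down kj Tj)) Tj kj

  elim≤-image : WellFounded E′ → Elim E S d → I.DownClosed T → Preimage T ⊆ S →
                DoubleNegation (I.Elim≤ T d)
  elim≤-image wf (empty ∅S) down pre =
    return (0 , z≤n , empty (λ i Ti → let (x , x↦i) = ↦-surjective i in ∅S x (pre (i , x↦i , Ti))))
  elim≤-image {S = S} {T = T} wf (split {v = w} _ _ eC eR) down pre = do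
    X? ← ¬¬-decidable X
    (_ , ≤c₁ , e₁) ← elim≤-image wf eC downX preX
    (_ , ≤c₂ , e₂) ← elim≤-image wf eR downY preY
    (d , d≤ , e) ← I.elim≤-union e₁ e₂ (partition-≐ X?) (λ ((_ , Xi) , (_ , ¬Xi)) → ¬Xi Xi)
                     (λ (Ti , Xi) (Tj , ¬Xj) ij → ¬Xj (spread Ti Tj ij Xi))
    return (d , ≤-trans d≤ (⊔-mono-≤ ≤c₁ ≤c₂) , e)
    where
    X : Pred (Fin M) 0ℓ
    X i = ∃[ y ] y ↦ i × Linked E S w y
    spread : T i → T j → I.Edge i j → X i → X j
    spread Ti Tj ij (y , y↦i , wy) =
      let (x , z , x↦i , z↦j , xz) = edge-lift ij
      in z , z↦j , step (fibre-linked y↦i x↦i (pre (_ , x↦i , Ti)) wy) (pre (_ , z↦j , Tj)) xz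
    downX : I.DownClosed (T ∩ X)
    downX ij (Tj , Xj) = down ij Tj , spread Tj (down ij Tj) (inj₂ ij) Xj
    preX : Preimage (T ∩ X) ⊆ Linked E S w
    preX (i , y↦i , Ti , x , x↦i , wx) = fibre-linked x↦i y↦i (pre (i , y↦i , Ti)) wx
    downY : I.DownClosed (T ∖ X)
    downY ij (Tj , ¬Xj) = down ij Tj , λ Xi → ¬Xj (spread (down ij Tj) Tj (inj₁ ij) Xi)
    preY : Preimage (T ∖ X) ⊆ S ∖ Linked E S w
    preY (j , y↦j , Tj , ¬Xj) = pre (j , y↦j , Tj) , λ wy → ¬Xj (_ , y↦j , wy)
  elim≤-image {T = T} wf (root {s = s} {d = c} _ _ eR) down pre = do
    yes (i , s↦i , Ti) ← ¬¬-excluded-middle {A = ∃[ i ] s ↦ i × T i}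
      where no ∄ → ¬¬-map (I.elim≤-weaken (n≤1+n c)) (elim≤-image wf eR down (avoid ∄))
    (_ , ≤c , e) ← elim≤-image wf eR (λ kj (Tj , ¬ij) → down kj Tj , λ ik → ¬ij (step ik Tj kj))
                     (λ (j , y↦j , Tj , ¬ij) →
                        pre (j , y↦j , Tj) , λ sy → ¬ij (reach-image down sy s↦i y↦j Tj))
    ¬¬-map (I.elim≤-weaken (s≤s ≤c)) (I.elim≤-removeReach wf Ti e)
    where
    avoid : ¬ (∃[ i ] s ↦ i × T i) → Preimage T ⊆ _
    avoid ∄ p@(j , y↦j , Tj) = pre p , λ sy →
      let (i , s↦i) = reach-domain sy y↦j
      in  ∄ (i , s↦i , I.reach-start (reach-image down sy s↦i y↦j Tj))

  dagDtdAtLeast-pullback : WellFounded E′ → ∀ k → DagDtdAtLeast E′ k → DagDtdAtLeast E k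
  dagDtdAtLeast-pullback wf k k≤ d e = decidable-stable (k ≤? d)
    (¬¬-map (λ (d′ , d′≤d , e′) → ≤-trans (k≤ d′ e′) d′≤d)
            (elim≤-image {T = λ _ → ⊤} wf e (λ _ _ → tt) (λ _ → tt)))

acyclic⇒wellFounded : ∀ {n} {E : Rel (Fin n) 0ℓ} → (∀ u → ¬ TransClosure E u u) → WellFounded E
acyclic⇒wellFounded {E = E} acyclic = wellFounded⁻ E (spo-wellFounded isStrictPartialOrder)
  where
  isStrictPartialOrder : IsStrictPartialOrder _≡_ (TransClosure E)
  isStrictPartialOrder = record
    { isEquivalence = isEquivalence
    ; irrefl        = λ { refl → acyclic _ }
    ; trans         = _++_
    ; <-resp-≈      = (λ { refl xy → xy }) , (λ { refl xy → xy })
    }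

⊆-strict⇒acyclic : ∀ {a} {A : Set a} {E R : Rel A 0ℓ} →
                   E ⇒ R → Transitive R → (∀ {x} → ¬ R x x) → ∀ u → ¬ TransClosure E u u
⊆-strict⇒acyclic {E = E} {R} E⇒R R-trans R-irrefl u = R-irrefl ∘ strict
  where
  strict : ∀ {x y} → TransClosure E x y → R x y
  strict [ xy ]⁺    = E⇒R xy
  strict (xy ∷ yz) = R-trans (E⇒R xy) (strict yz)

adj⇒≢ : ∀ {n} (G : Graph n) {x y} → Adj G x y → x ≢ y
adj⇒≢ G xy refl = irrefl G xy

LiftsOrientations : ∀ {m n} → Graph m → Graph n → Set₁
LiftsOrientations I H =
  (O : AcyclicOrientation I) → Σ[ O′ ∈ AcyclicOrientation H ] MinorModel (Arc O′) (Arc O)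

dtdAtLeast-lift : ∀ {m n} {I : Graph m} {H : Graph n} →
                  LiftsOrientations I H → ∀ k → DtdAtLeast I k → DtdAtLeast H k
dtdAtLeast-lift lift k (O , k≤) =
  let (O′ , model) = lift O in O′ , dagDtdAtLeast-pullback model (acyclic⇒wellFounded (acyclic O)) k k≤

≅-lifts : ∀ {m n} {I : Graph m} {H : Graph n} → I ≅ H → LiftsOrientations I H
≅-lifts {I = I} {H} I≅H O = O′ , model
  where
  open _≅_ I≅H
  O′ : AcyclicOrientation H
  O′ = record
    { Arc     = λ x y → Arc O (from x) (from y)
    ; arc⇒adj = λ xy → subst₂ (Adj H) (to∘from _) (to∘from _) (pres (arc⇒adj O xy))
    ; adj⇒arc = λ xy → adj⇒arc O (refl' (subst₂ (Adj H) (sym (to∘from _)) (sym (to∘from _)) xy))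
    ; acyclic = ⊆-strict⇒acyclic [_]⁺ _++_ (acyclic O _)
    }
  model : MinorModel (Arc O′) (Arc O)
  model = record
    { _↦_          = λ x i → from x ≡ i
    ; ↦-functional = λ p q → trans (sym p) q
    ; ↦-surjective = λ i → to i , from∘to i
    ; ↦-downward   = λ _ _ → _ , refl
    ; arc-image    = λ { xy refl refl → inj₂ xy }
    ; arc-lift     = λ ij → to _ , to _ , from∘to _ , from∘to _ ,
                            inj₁ (subst₂ (Arc O) (sym (from∘to _)) (sym (from∘to _)) ij)
    ; fibre-clique = λ p q →
                       inj₁ (trans (sym (to∘from _)) (trans (cong to (trans p (sym q))) (to∘from _)))
    }

data PunchInView {n} (v : Fin (suc n)) : Fin (suc n) → Set where
  removed : PunchInView v v
  kept    : ∀ i → PunchInView v (punchIn v i)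

punchIn-view : ∀ {n} (v x : Fin (suc n)) → PunchInView v x
punchIn-view v x with v ≟ x
... | yes refl = removed
... | no  v≢x  = subst (PunchInView v) (punchIn-punchOut v≢x) (kept (punchOut v≢x))

module Deletion {n} (H : Graph (suc n)) (v : Fin (suc n)) (O : AcyclicOrientation (deleteVertex H v)) where

  data Arc⁺ : Rel (Fin (suc n)) 0ℓ where
    kept      : ∀ {i j} → Arc O i j → Arc⁺ (punchIn v i) (punchIn v j)
    toDeleted : ∀ {x} → Adj H x v → Arc⁺ x v

  Below : Rel (Fin (suc n)) 0ℓ
  Below x y = (∃₂ λ i j → x ≡ punchIn v i × y ≡ punchIn v j × TransClosure (Arc O) i j)
            ⊎ (x ≢ v × y ≡ v)

  arc⇒below : Arc⁺ ⇒ Below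
  arc⇒below (kept ij)     = inj₁ (_ , _ , refl , refl , [ ij ]⁺)
  arc⇒below (toDeleted a) = inj₂ (adj⇒≢ H a , refl)

  below-trans : Transitive Below
  below-trans (inj₁ (i , j , refl , refl , ij)) (inj₁ (j′ , k , p , refl , jk))
    with punchIn-injective v j j′ p
  ... | refl = inj₁ (i , k , refl , refl , ij ++ jk)
  below-trans (inj₁ (i , _ , refl , _ , _)) (inj₂ (_ , refl)) = inj₂ (punchInᵢ≢i v i , refl)
  below-trans (inj₂ (_ , refl)) (inj₁ (j , _ , p , _ , _))   = ⊥-elim (punchInᵢ≢i v j (sym p))
  below-trans (inj₂ (_ , refl)) (inj₂ (v≢v , _))             = ⊥-elim (v≢v refl)

  below-irrefl : ∀ {x} → ¬ Below x x
  below-irrefl (inj₁ (i , j , p , q , ij)) with punchIn-injective v i j (trans (sym p) q)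
  ... | refl = acyclic O i ij
  below-irrefl (inj₂ (x≢v , x≡v)) = x≢v x≡v

  adj⇒arc⁺ : ∀ {x y} → Adj H x y → Arc⁺ x y ⊎ Arc⁺ y x
  adj⇒arc⁺ {x} {y} xy with punchIn-view v x | punchIn-view v y
  ... | removed | _       = inj₂ (toDeleted (symm H xy))
  ... | kept _  | removed = inj₁ (toDeleted xy)
  ... | kept _  | kept _  = Sum.map kept kept (adj⇒arc O xy)

  O⁺ : AcyclicOrientation H
  O⁺ = record
    { Arc     = Arc⁺
    ; arc⇒adj = λ { (kept ij) → arc⇒adj O ij ; (toDeleted xv) → xv }
    ; adj⇒arc = adj⇒arc⁺
    ; acyclic = ⊆-strict⇒acyclic arc⇒below below-trans below-irrefl
    }

  model : MinorModel Arc⁺ (Arc O)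
  model = record
    { _↦_          = λ x i → x ≡ punchIn v i
    ; ↦-functional = λ p q → punchIn-injective v _ _ (trans (sym p) q)
    ; ↦-surjective = λ i → punchIn v i , refl
    ; ↦-downward   = λ { (kept _) _ → _ , refl ; (toDeleted _) q → ⊥-elim (punchInᵢ≢i v _ (sym q)) }
    ; arc-image    = arc-image
    ; arc-lift     = λ ij → _ , _ , refl , refl , inj₁ (kept ij)
    ; fibre-clique = λ p q → inj₁ (trans p (sym q))
    }
    where
    arc-image : ∀ {x y i j} → Arc⁺ x y → x ≡ punchIn v i → y ≡ punchIn v j → i ≡ j ⊎ Arc O i j
    arc-image (kept ij) p q = inj₂ (subst₂ (Arc O) (punchIn-injective v _ _ p) (punchIn-injective v _ _ q) ij)
    arc-image (toDeleted _) _ q = ⊥-elim (punchInᵢ≢i v _ (sym q))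

deleteVertex-lifts : ∀ {n} (H : Graph (suc n)) v → LiftsOrientations (deleteVertex H v) H
deleteVertex-lifts H v O = Deletion.O⁺ H v O , Deletion.model H v O

module Contraction {n} (H : Graph (suc n)) (u v : Fin (suc n)) (uv : Adj H u v)
                   (O : AcyclicOrientation (contract H u v uv)) where

  data _↦_ : Fin (suc n) → Fin n → Set where
    kept   : ∀ {x i} → x ≡ punchIn v i → x ↦ i
    merged : ∀ {i} → punchIn v i ≡ u → v ↦ i

  ↦-functional : ∀ {x i j} → x ↦ i → x ↦ j → i ≡ j
  ↦-functional (kept p)   (kept q)   = punchIn-injective v _ _ (trans (sym p) q)
  ↦-functional (kept p)   (merged _) = ⊥-elim (punchInᵢ≢i v _ (sym p))
  ↦-functional (merged _) (kept q)   = ⊥-elim (punchInᵢ≢i v _ (sym q))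
  ↦-functional (merged p) (merged q) = punchIn-injective v _ _ (trans p (sym q))

  image : ∀ x → ∃[ i ] x ↦ i
  image x with punchIn-view v x
  ... | removed = _ , merged (punchIn-punchOut (adj⇒≢ H (symm H uv)))
  ... | kept i  = i , kept refl

  u↦⇒v↦ : ∀ {i} → u ↦ i → v ↦ i
  u↦⇒v↦ (kept p)   = merged (sym p)
  u↦⇒v↦ (merged _) = ⊥-elim (adj⇒≢ H uv refl)

  v↦⇒u↦ : ∀ {i} → v ↦ i → u ↦ i
  v↦⇒u↦ (kept p)   = ⊥-elim (punchInᵢ≢i v _ (sym p))
  v↦⇒u↦ (merged p) = kept (sym p)

  data Arc⁺ : Rel (Fin (suc n)) 0ℓ where
    lifted     : ∀ {x y i j} → Adj H x y → x ↦ i → y ↦ j → Arc O i j → Arc⁺ x y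
    contracted : Arc⁺ u v

  Below : Rel (Fin (suc n)) 0ℓ
  Below x y = (∃₂ λ i j → x ↦ i × y ↦ j × TransClosure (Arc O) i j) ⊎ (x ≡ u × y ≡ v)

  arc⇒below : Arc⁺ ⇒ Below
  arc⇒below (lifted _ x↦i y↦j ij) = inj₁ (_ , _ , x↦i , y↦j , [ ij ]⁺)
  arc⇒below contracted            = inj₂ (refl , refl)

  below-trans : Transitive Below
  below-trans (inj₁ (i , j , x↦i , y↦j , ij)) (inj₁ (j′ , k , y↦j′ , z↦k , jk))
    with ↦-functional y↦j y↦j′
  ... | refl = inj₁ (i , k , x↦i , z↦k , ij ++ jk)
  below-trans (inj₁ (i , j , x↦i , u↦j , ij)) (inj₂ (refl , refl)) =
    inj₁ (i , j , x↦i , u↦⇒v↦ u↦j , ij)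
  below-trans (inj₂ (refl , refl)) (inj₁ (j , k , v↦j , z↦k , jk)) =
    inj₁ (j , k , v↦⇒u↦ v↦j , z↦k , jk)
  below-trans (inj₂ (refl , refl)) (inj₂ (v≡u , _))                = ⊥-elim (adj⇒≢ H uv (sym v≡u))

  below-irrefl : ∀ {x} → ¬ Below x x
  below-irrefl (inj₁ (i , j , x↦i , x↦j , ij)) with ↦-functional x↦i x↦j
  ... | refl = acyclic O i ij
  below-irrefl (inj₂ (refl , u≡v)) = adj⇒≢ H uv u≡v

  fibre-clique : ∀ {x y i} → x ↦ i → y ↦ i → x ≡ y ⊎ (Arc⁺ x y ⊎ Arc⁺ y x)
  fibre-clique (kept p)   (kept q)   = inj₁ (trans p (sym q))
  fibre-clique (kept p)   (merged q) with trans p q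
  ... | refl = inj₂ (inj₁ contracted)
  fibre-clique (merged p) (kept q)   with trans q p
  ... | refl = inj₂ (inj₂ contracted)
  fibre-clique (merged _) (merged _) = inj₁ refl

  contracted-adj : ∀ {x y i j} → Adj H x y → x ↦ i → y ↦ j → i ≢ j → Adj (contract H u v uv) i j
  contracted-adj xy (kept refl) (kept refl) i≢j = inj₁ xy , i≢j
  contracted-adj xy (kept refl) (merged q)  i≢j = inj₂ (inj₂ (q , xy)) , i≢j
  contracted-adj xy (merged p)  (kept refl) i≢j = inj₂ (inj₁ (p , xy)) , i≢j
  contracted-adj xy (merged _)  (merged _)  _   = ⊥-elim (irrefl H xy)

  adj⇒arc⁺ : ∀ {x y} → Adj H x y → Arc⁺ x y ⊎ Arc⁺ y x
  adj⇒arc⁺ {x} {y} xy with image x | image y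
  ... | i , x↦i | j , y↦j with i ≟ j
  ... | yes refl = Sum.fromInj₂ (λ x≡y → ⊥-elim (adj⇒≢ H xy x≡y)) (fibre-clique x↦i y↦j)
  ... | no i≢j   = Sum.map (lifted xy x↦i y↦j) (lifted (symm H xy) y↦j x↦i)
                     (adj⇒arc O (contracted-adj xy x↦i y↦j i≢j))

  arc-lift : ∀ {i j} → Arc O i j → ∃₂ λ x y → x ↦ i × y ↦ j × (Arc⁺ x y ⊎ Arc⁺ y x)
  arc-lift ij with proj₁ (arc⇒adj O ij)
  ... | inj₁ xy            = _ , _ , kept refl , kept refl , inj₁ (lifted xy (kept refl) (kept refl) ij)
  ... | inj₂ (inj₁ (p , xy)) = _ , _ , merged p  , kept refl , inj₁ (lifted xy (merged p) (kept refl) ij)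
  ... | inj₂ (inj₂ (q , xy)) = _ , _ , kept refl , merged q  , inj₁ (lifted xy (kept refl) (merged q) ij)

  O⁺ : AcyclicOrientation H
  O⁺ = record
    { Arc     = Arc⁺
    ; arc⇒adj = λ { (lifted xy _ _ _) → xy ; contracted → uv }
    ; adj⇒arc = adj⇒arc⁺
    ; acyclic = ⊆-strict⇒acyclic arc⇒below below-trans below-irrefl
    }

  model : MinorModel Arc⁺ (Arc O)
  model = record
    { _↦_          = _↦_
    ; ↦-functional = ↦-functional
    ; ↦-surjective = λ i → punchIn v i , kept refl
    ; ↦-downward   = λ {x} _ _ → image x
    ; arc-image    = arc-image
    ; arc-lift     = arc-lift
    ; fibre-clique = fibre-clique
    }
    where
    arc-image : ∀ {x y i j} → Arc⁺ x y → x ↦ i → y ↦ j → i ≡ j ⊎ Arc O i j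
    arc-image (lifted _ x↦i y↦j ij) x↦i′ y↦j′ =
      inj₂ (subst₂ (Arc O) (↦-functional x↦i x↦i′) (↦-functional y↦j y↦j′) ij)
    arc-image contracted u↦i v↦j = inj₁ (↦-functional (u↦⇒v↦ u↦i) v↦j)

contract-lifts : ∀ {n} (H : Graph (suc n)) u v (uv : Adj H u v) → LiftsOrientations (contract H u v uv) H
contract-lifts H u v uv O = Contraction.O⁺ H u v uv O , Contraction.model H u v uv O

mainTheorem13 : {m n : ℕ} (H : Graph n) (I : Graph m) →
    I ≤IM H → (k : ℕ) → DtdAtLeast I k → DtdAtLeast H k
mainTheorem13 H I (iso I≅H) = dtdAtLeast-lift (≅-lifts I≅H)
mainTheorem13 H I (del v I≤H∖v) k =
  dtdAtLeast-lift (deleteVertex-lifts H v) k ∘ mainTheorem13 (deleteVertex H v) I I≤H∖v k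
mainTheorem13 H I (con u v uv I≤H/uv) k =
  dtdAtLeast-lift (contract-lifts H u v uv) k ∘ mainTheorem13 (contract H u v uv) I I≤H/uv k
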